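{- Let $\varphi$ be a CNF formula on $n$ variables with clause set $C$. Partition the variables into two groups of $n/2$ variables each. Let $A$ be the set of all assignments to the first group and $B$ the set of all assignments to the second group, and set $N=2^{n/2}=|A|=|B|$. Build a directed capacitated graph with node set $A\cup B\cup C\cup\{s,t\}$ and the following edges: - an edge $(a,c)$ of capacity $N$ for every $a\in A$ and $c\in C$ such that the partial assignment $a$ does not satisfy clause $c$; - an edge $(c,b)$ of capacity $1$ for every $b\in B$ and $c\in C$ such that $b$ does not satisfy $c$; - an edge $(b,t)$ of capacity $1$ for every $b\in B$. Enumerate $A=\{a_1,\dots,a_N\}$ and perform phases $i=1,\dots,N$. Phase $i$ consists of: 1. add the edge $(s,a_i)$ with capacity $N$; 2. query the maximum $s$–$t$ flow value; 3. add the edge $(a_i,t)$ with capacity $N$. Then: if for some phase $i$ the queried maximum flow value is $<i\cdot N$, the formula $\varphi$ is satisfiable; otherwise $\varphi$ is not satisfiable.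
   Context: A partial assignment satisfies a clause if it sets at least one literal of the clause to true. It does not satisfy the clause otherwise. -}

module Defs where

open import Data.Nat using (ℕ; zero; suc; _+_; _*_; _^_; _≤?_; _<?_)
open import Data.Fin using (Fin; toℕ; splitAt)
open import Data.Fin.Properties using () renaming (_≟_ to _≟ᶠ_)
open import Data.Bool using (Bool; true; false; if_then_else_)
open import Data.Bool.Properties using () renaming (_≟_ to _≟ᵇ_)
open import Data.Vec using (Vec; lookup)
open import Data.List using (List; []; _∷_; map; _++_; foldr; length; allFin)
import Data.List as List
open import Data.List.Relation.Unary.Any using (Any; any?)
open import Data.List.Relation.Unary.All using (All)
open import Data.Product using (Σ; _×_; _,_; ∃; ∃-syntax)
open import Data.Sum using (_⊎_; inj₁; inj₂)
open import Data.Empty using (⊥)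
open import Data.Rational using (ℚ; 0ℚ) renaming (_+_ to _+ℚ_; _-_ to _-ℚ_; _≤_ to _≤ℚ_)
import Data.Rational as ℚ
import Data.Integer as ℤ
open import Relation.Binary.PropositionalEquality using (_≡_)
open import Relation.Nullary using (¬_; Dec; yes; no; does)

-- CNF formulas on n = k + k variables.
-- Variables are Fin (k + k); variable x belongs to the first group iff
-- splitAt k x = inj₁ _, to the second group iff splitAt k x = inj₂ _.

-- A literal is a variable together with a polarity
-- (true = positive literal x, false = negated literal ¬x).
Literal : ℕ → Set
Literal k = Fin (k + k) × Bool

Clause : ℕ → Set
Clause k = List (Literal k)

-- A CNF formula: a list of clauses (the clause set C is indexed by
-- positions Fin (length φ)).
CNF : ℕ → Set
CNF k = List (Clause k)

Assign : ℕ → Set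
Assign k = Vec Bool k

SatLit : ∀ {k} → (Fin (k + k) → Bool) → Literal k → Set
SatLit σ (x , p) = σ x ≡ p

SatClause : ∀ {k} → (Fin (k + k) → Bool) → Clause k → Set
SatClause {k} σ c = Any (SatLit {k} σ) c

Satisfiable : ∀ {k} → CNF k → Set
Satisfiable {k} φ = ∃[ σ ] All (SatClause {k} σ) φ

SatLitA : ∀ {k} → Assign k → Literal k → Set
SatLitA {k} a (x , p) with splitAt k x
... | inj₁ i = lookup a i ≡ p
... | inj₂ _ = ⊥

SatLitB : ∀ {k} → Assign k → Literal k → Set
SatLitB {k} b (x , p) with splitAt k x
... | inj₁ _ = ⊥
... | inj₂ j = lookup b j ≡ p

SatClauseA : ∀ {k} → Assign k → Clause k → Set
SatClauseA a c = Any (SatLitA a) c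

SatClauseB : ∀ {k} → Assign k → Clause k → Set
SatClauseB b c = Any (SatLitB b) c

satLitA? : ∀ {k} (a : Assign k) (l : Literal k) → Dec (SatLitA a l)
satLitA? {k} a (x , p) with splitAt k x
... | inj₁ i = lookup a i ≟ᵇ p
... | inj₂ _ = no (λ ())

satLitB? : ∀ {k} (b : Assign k) (l : Literal k) → Dec (SatLitB b l)
satLitB? {k} b (x , p) with splitAt k x
... | inj₁ _ = no (λ ())
... | inj₂ j = lookup b j ≟ᵇ p

satClauseA? : ∀ {k} (a : Assign k) (c : Clause k) → Dec (SatClauseA a c)
satClauseA? a c = any? (satLitA? a) c

satClauseB? : ∀ {k} (b : Assign k) (c : Clause k) → Dec (SatClauseB b c)
satClauseB? b c = any? (satLitB? b) c

ℕtoℚ : ℕ → ℚ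
ℕtoℚ n = ℤ.+ n ℚ./ 1

sumℚ : List ℚ → ℚ
sumℚ = foldr _+ℚ_ 0ℚ

record Network : Set₁ where
  field
    V     : Set
    nodes : List V          -- an enumeration of all nodes (each exactly once)
    s t   : V
    cap   : V → V → ℕ       -- capacity; 0 means "no edge"

module _ (G : Network) where
  open Network G

  inflow : (V → V → ℚ) → V → ℚ
  inflow f v = sumℚ (map (λ u → f u v) nodes)

  outflow : (V → V → ℚ) → V → ℚ
  outflow f v = sumℚ (map (λ w → f v w) nodes)

  record IsFlow (f : V → V → ℚ) : Set where
    field
      nonneg       : ∀ u v → 0ℚ ≤ℚ f u v
      capacity     : ∀ u v → f u v ≤ℚ ℕtoℚ (cap u v)
      conservation : ∀ v → ¬ v ≡ s → ¬ v ≡ t → inflow f v ≡ outflow f v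

  flowValue : (V → V → ℚ) → ℚ
  flowValue f = outflow f s -ℚ inflow f s

  IsMaxFlowValue : ℚ → Set
  IsMaxFlowValue val =
    (∃[ f ] (IsFlow f × flowValue f ≡ val)) ×
    (∀ f → IsFlow f → flowValue f ≤ℚ val)

-- N = 2 ^ k; the set A (resp. B) of
-- assignments to the first (resp. second) group is enumerated by a
-- bijection e : Fin N → Assign k, so node nodeA j stands for a_{j+1} = e j
-- and node nodeB j stands for the assignment e j to the second group.

data Node (N m : ℕ) : Set where
  src snk : Node N m
  nodeA   : Fin N → Node N m
  nodeB   : Fin N → Node N m
  nodeC   : Fin m → Node N m

allNodes : (N m : ℕ) → List (Node N m)
allNodes N m = src ∷ snk ∷ (map nodeA (allFin N) ++ map nodeB (allFin N) ++ map nodeC (allFin m))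

-- Capacities of the graph at the moment of the query in phase i
-- (i : Fin N stands for phase i+1): edges (s,a_j) for all j ≤ i
-- (added in phases 1..i+1), edges (a_j,t) for all j < i (added in
-- phases 1..i), plus the fixed edges A→C, C→B, B→t.
phaseCap : ∀ {k} (φ : CNF k) (e : Fin (2 ^ k) → Assign k) (i : Fin (2 ^ k)) →
           Node (2 ^ k) (length φ) → Node (2 ^ k) (length φ) → ℕ
phaseCap {k} φ e i src (nodeA j) = if does (toℕ j ≤? toℕ i) then 2 ^ k else 0
phaseCap {k} φ e i (nodeA j) snk = if does (toℕ j <? toℕ i) then 2 ^ k else 0
phaseCap {k} φ e i (nodeA j) (nodeC c) =
  if does (satClauseA? (e j) (List.lookup φ c)) then 0 else 2 ^ k
phaseCap {k} φ e i (nodeC c) (nodeB j) =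
  if does (satClauseB? (e j) (List.lookup φ c)) then 0 else 1
phaseCap {k} φ e i (nodeB j) snk = 1
phaseCap {k} φ e i _ _ = 0

phaseNetwork : ∀ {k} (φ : CNF k) (e : Fin (2 ^ k) → Assign k) (i : Fin (2 ^ k)) → Network
phaseNetwork {k} φ e i = record
  { V = Node (2 ^ k) (length φ)
  ; nodes = allNodes (2 ^ k) (length φ)
  ; s = src
  ; t = snk
  ; cap = phaseCap φ e i
  }

-- Count phases from 1 and let β be the number of assignments b to the second group that are
-- incompatible with a_i, i.e. some clause is falsified by both a_i and b.  In phase i the maximum
-- flow has value (i − 1)·N + β: a flow of this value sends N units along s → a_j → t for every
-- j < i and, for every incompatible b, one unit along s → a_i → c → b → t through a clause c
-- falsified by a_i and b, while the cut whose source side consists of s, a_i, the clauses not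
-- satisfied by a_i and the incompatible b has the same capacity.  So the query of phase i is below
-- i·N exactly when some b is compatible with a_i, that is, when a_i and b together satisfy φ.
module Submission where

open import Defs
open import Data.Nat using (ℕ; zero; suc; _+_; _*_; _^_; z≤n)
import Data.Nat as ℕ
import Data.Nat.Properties as ℕₚ
open import Data.Nat.Coprimality using (1-coprimeTo) renaming (sym to coprime-sym)
open import Data.Nat.ListAction using (sum)
open import Data.Nat.ListAction.Properties using (sum-++)
import Data.Integer as ℤ
import Data.Integer.Properties as ℤₚ
open import Data.Rational using (ℚ; mkℚ; 0ℚ; *≤*; _<_; _≤_)
import Data.Rational as ℚ
import Data.Rational.Properties as ℚₚ
open import Data.Rational.Solver using (module +-*-Solver)
open import Data.Fin using (Fin; zero; suc; toℕ; _≟_; splitAt; join)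
import Data.Fin.Properties as Finₚ
open import Data.Bool using (Bool; true; false; if_then_else_; not)
open import Data.Vec as Vec using ()
import Data.Vec.Properties as Vecₚ
open import Data.List using (List; []; _∷_; map; length; allFin; tabulate; _++_)
import Data.List as List
import Data.List.Properties as Listₚ
open import Data.List.Relation.Unary.All using (All; []; _∷_; universal)
import Data.List.Relation.Unary.All.Properties as All
import Data.List.Relation.Unary.Any as Any
import Data.List.Relation.Unary.Any.Properties as Anyₚ
open import Data.Product using (_×_; _,_; ∃; ∃-syntax; proj₁; proj₂)
open import Data.Sum using (_⊎_; inj₁; inj₂; [_,_]′)
open import Algebra.Bundles using (CommutativeMonoid)
import Algebra.Properties.CommutativeSemigroup as CommutativeSemigroupProperties
open import Algebra.Properties.CommutativeMonoid.Sum ℕₚ.+-0-commutativeMonoid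
  using (sum-syntax; ∑-comm; ∑-distrib-+; sum-cong-≗) renaming (sum to ∑; sum-replicate-zero to ∑-zero)
open import Function using (_∘_)
open import Function.Definitions using (Bijective)
open import Relation.Binary.Definitions using (tri<; tri≈; tri>)
open import Relation.Binary.PropositionalEquality
open import Relation.Nullary using (¬_; contradiction; Dec; yes; no; does; ¬?; _×-dec_)
open import Relation.Nullary.Decidable using (dec-true; dec-false; decidable-stable)

open CommutativeSemigroupProperties (CommutativeMonoid.commutativeSemigroup ℚₚ.+-0-commutativeMonoid)
  using () renaming (interchange to +-interchange)

ℕtoℚ-mkℚ : ∀ n → ℕtoℚ n ≡ mkℚ (ℤ.+ n) 0 (coprime-sym (1-coprimeTo n))
ℕtoℚ-mkℚ n = ℚₚ.normalize-coprime (coprime-sym (1-coprimeTo n))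

ℕtoℚ-homo-+ : ∀ m n → ℕtoℚ (m + n) ≡ ℕtoℚ m ℚ.+ ℕtoℚ n
ℕtoℚ-homo-+ m n
  rewrite ℕtoℚ-mkℚ m | ℕtoℚ-mkℚ n | ℤₚ.*-identityʳ (ℤ.+ m) | ℤₚ.*-identityʳ (ℤ.+ n) = refl

ℕtoℚ-mono-≤ : ∀ {m n} → m ℕ.≤ n → ℕtoℚ m ≤ ℕtoℚ n
ℕtoℚ-mono-≤ {m} {n} m≤n rewrite ℕtoℚ-mkℚ m | ℕtoℚ-mkℚ n =
  *≤* (subst₂ ℤ._≤_ (sym (ℤₚ.*-identityʳ (ℤ.+ m))) (sym (ℤₚ.*-identityʳ (ℤ.+ n)))
                    (ℤ.+≤+ m≤n))

ℕtoℚ-cancel-≤ : ∀ {m n} → ℕtoℚ m ≤ ℕtoℚ n → m ℕ.≤ n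
ℕtoℚ-cancel-≤ {m} {n} le rewrite ℕtoℚ-mkℚ m | ℕtoℚ-mkℚ n with le
... | *≤* m≤n =
  ℤₚ.drop‿+≤+ (subst₂ ℤ._≤_ (ℤₚ.*-identityʳ (ℤ.+ m)) (ℤₚ.*-identityʳ (ℤ.+ n)) m≤n)

0≤ℕtoℚ : ∀ n → 0ℚ ≤ ℕtoℚ n
0≤ℕtoℚ n = ℕtoℚ-mono-≤ {0} {n} z≤n

p+r≤q+r+s⇒p-q≤s : ∀ p q r s → p ℚ.+ r ≤ (q ℚ.+ r) ℚ.+ s → p ℚ.- q ≤ s
p+r≤q+r+s⇒p-q≤s p q r s le = begin
  p ℚ.- q                          ≡⟨ shift p q r ⟩
  (p ℚ.+ r) ℚ.- (q ℚ.+ r)          ≤⟨ ℚₚ.+-monoˡ-≤ (ℚ.- (q ℚ.+ r)) le ⟩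
  ((q ℚ.+ r) ℚ.+ s) ℚ.- (q ℚ.+ r)  ≡⟨ unshift (q ℚ.+ r) s ⟩
  s                                ∎
  where
  open ℚₚ.≤-Reasoning
  open +-*-Solver
  shift : ∀ p q r → p ℚ.- q ≡ (p ℚ.+ r) ℚ.- (q ℚ.+ r)
  shift = solve 3 (λ p q r → p :- q := (p :+ r) :- (q :+ r)) refl
  unshift : ∀ x s → (x ℚ.+ s) ℚ.- x ≡ s
  unshift = solve 2 (λ x s → (x :+ s) :- x := s) refl

module _ {A : Set} where

  sumℚ-ℕtoℚ : ∀ (h : A → ℕ) xs → sumℚ (map (ℕtoℚ ∘ h) xs) ≡ ℕtoℚ (sum (map h xs))
  sumℚ-ℕtoℚ h []       = refl
  sumℚ-ℕtoℚ h (x ∷ xs) =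
    trans (cong (ℕtoℚ (h x) ℚ.+_) (sumℚ-ℕtoℚ h xs)) (sym (ℕtoℚ-homo-+ (h x) _))

  sumℚ-cong : ∀ {h k : A → ℚ} → (∀ x → h x ≡ k x) → ∀ xs → sumℚ (map h xs) ≡ sumℚ (map k xs)
  sumℚ-cong h≗k xs = cong sumℚ (Listₚ.map-cong h≗k xs)

  sumℚ-mono-≤ : ∀ {h k : A → ℚ} → (∀ x → h x ≤ k x) → ∀ xs → sumℚ (map h xs) ≤ sumℚ (map k xs)
  sumℚ-mono-≤ h≤k []       = ℚₚ.≤-refl
  sumℚ-mono-≤ h≤k (x ∷ xs) = ℚₚ.+-mono-≤ (h≤k x) (sumℚ-mono-≤ h≤k xs)

  sumℚ-zero : ∀ xs → sumℚ (map (λ (_ : A) → 0ℚ) xs) ≡ 0ℚ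
  sumℚ-zero []       = refl
  sumℚ-zero (x ∷ xs) = trans (ℚₚ.+-identityˡ _) (sumℚ-zero xs)

  sumℚ-+ : ∀ (h k : A → ℚ) xs →
           sumℚ (map (λ x → h x ℚ.+ k x) xs) ≡ sumℚ (map h xs) ℚ.+ sumℚ (map k xs)
  sumℚ-+ h k []       = sym (ℚₚ.+-identityˡ 0ℚ)
  sumℚ-+ h k (x ∷ xs) =
    trans (cong (h x ℚ.+ k x ℚ.+_) (sumℚ-+ h k xs))
          (+-interchange (h x) (k x) (sumℚ (map h xs)) (sumℚ (map k xs)))

  sumℚ-if : ∀ b (h : A → ℚ) xs →
            (if b then sumℚ (map h xs) else 0ℚ) ≡ sumℚ (map (λ x → if b then h x else 0ℚ) xs)
  sumℚ-if true  h xs = refl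
  sumℚ-if false h xs = sym (sumℚ-zero xs)

sumℚ-swap : ∀ {A B : Set} (F : A → B → ℚ) xs ys →
  sumℚ (map (λ x → sumℚ (map (F x) ys)) xs) ≡ sumℚ (map (λ y → sumℚ (map (λ x → F x y) xs)) ys)
sumℚ-swap F []       ys = sym (sumℚ-zero ys)
sumℚ-swap F (x ∷ xs) ys =
  trans (cong (sumℚ (map (F x) ys) ℚ.+_) (sumℚ-swap F xs ys))
        (sym (sumℚ-+ (F x) (λ y → sumℚ (map (λ x → F x y) xs)) ys))

sum-map-zero : ∀ {A : Set} (xs : List A) → sum (map (λ _ → 0) xs) ≡ 0
sum-map-zero []       = refl
sum-map-zero (x ∷ xs) = sum-map-zero xs

sum-tabulate : ∀ {n} (h : Fin n → ℕ) → sum (tabulate h) ≡ ∑[ j < n ] h j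
sum-tabulate {zero}  h = refl
sum-tabulate {suc n} h = cong (h zero +_) (sum-tabulate (h ∘ suc))

sum-map-allFin : ∀ {A : Set} {n} (g : Fin n → A) (h : A → ℕ) →
                 sum (map h (map g (allFin n))) ≡ ∑[ j < n ] h (g j)
sum-map-allFin {n = n} g h = begin
  sum (map h (map g (allFin n)))  ≡⟨ cong sum (Listₚ.map-∘ (allFin n)) ⟨
  sum (map (h ∘ g) (allFin n))    ≡⟨ cong sum (Listₚ.map-tabulate (λ j → j) (h ∘ g)) ⟩
  sum (tabulate (h ∘ g))          ≡⟨ sum-tabulate (h ∘ g) ⟩
  ∑[ j < n ] h (g j)              ∎
  where open ≡-Reasoning

∑-ones : ∀ n → ∑[ j < n ] 1 ≡ n
∑-ones zero    = refl
∑-ones (suc n) = cong suc (∑-ones n)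

∑-δ : ∀ {n} (i : Fin n) x → ∑[ j < n ] (if does (j ≟ i) then x else 0) ≡ x
∑-δ {suc n} zero    x = trans (cong (x +_) (∑-zero n)) (ℕₚ.+-identityʳ x)
∑-δ {suc n} (suc i) x = ∑-δ i x

∑-if : ∀ {n} b (h : Fin n → ℕ) → ∑[ j < n ] (if b then h j else 0) ≡ (if b then ∑[ j < n ] h j else 0)
∑-if {n} true  h = refl
∑-if {n} false h = ∑-zero n

∑-below : ∀ {n} (i : Fin n) x → ∑[ j < n ] (if does (toℕ j ℕ.<? toℕ i) then x else 0) ≡ toℕ i * x
∑-below {suc n} zero    x = ∑-zero n
∑-below {suc n} (suc i) x = cong (x +_) (∑-below i x)

∑-mono-≤ : ∀ {n} {h k : Fin n → ℕ} → (∀ j → h j ℕ.≤ k j) → ∑[ j < n ] h j ℕ.≤ ∑[ j < n ] k j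
∑-mono-≤ {zero}  h≤k = z≤n
∑-mono-≤ {suc n} h≤k = ℕₚ.+-mono-≤ (h≤k zero) (∑-mono-≤ (h≤k ∘ suc))

∑-mono-< : ∀ {n} {h k : Fin n → ℕ} → (∀ j → h j ℕ.≤ k j) → ∀ i → h i ℕ.< k i →
           ∑[ j < n ] h j ℕ.< ∑[ j < n ] k j
∑-mono-< h≤k zero    h<k = ℕₚ.+-mono-<-≤ h<k (∑-mono-≤ (h≤k ∘ suc))
∑-mono-< h≤k (suc i) h<k = ℕₚ.+-mono-≤-< (h≤k zero) (∑-mono-< (h≤k ∘ suc) i h<k)

≤?-split : ∀ {n} (j i : Fin n) x →
  (if does (toℕ j ℕ.≤? toℕ i) then x else 0) ≡
  (if does (toℕ j ℕ.<? toℕ i) then x else 0) + (if does (j ≟ i) then x else 0)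
≤?-split j i x with ℕₚ.<-cmp (toℕ j) (toℕ i)
... | tri< j<i _ _
  rewrite dec-true (toℕ j ℕ.≤? toℕ i) (ℕₚ.<⇒≤ j<i) | dec-true (toℕ j ℕ.<? toℕ i) j<i
        | dec-false (j ≟ i) (λ { refl → ℕₚ.<-irrefl refl j<i }) = sym (ℕₚ.+-identityʳ x)
... | tri≈ _ j≡i _ with refl ← Finₚ.toℕ-injective j≡i
  rewrite dec-true (toℕ j ℕ.≤? toℕ j) ℕₚ.≤-refl | dec-false (toℕ j ℕ.<? toℕ j) (ℕₚ.<-irrefl refl)
        | dec-true (j ≟ j) refl = refl
... | tri> ¬j<i _ i<j
  rewrite dec-false (toℕ j ℕ.≤? toℕ i) (ℕₚ.<⇒≱ i<j) | dec-false (toℕ j ℕ.<? toℕ i) ¬j<i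
        | dec-false (j ≟ i) (λ { refl → ℕₚ.<-irrefl refl i<j }) = refl

indicator : ∀ {A : Set} → Dec A → ℕ
indicator d = if does d then 1 else 0

indicator-yes : ∀ {A : Set} (d : Dec A) → A → indicator d ≡ 1
indicator-yes d a rewrite dec-true d a = refl

indicator-no : ∀ {A : Set} (d : Dec A) → ¬ A → indicator d ≡ 0
indicator-no d ¬a rewrite dec-false d ¬a = refl

indicator≤1 : ∀ {A : Set} (d : Dec A) → indicator d ℕ.≤ 1
indicator≤1 (yes _) = ℕₚ.≤-refl
indicator≤1 (no _)  = z≤n

module _ {n} {P : Fin n → Set} where

  atWitness : Dec (∃ P) → Fin n → ℕ
  atWitness (yes (c , _)) j = if does (j ≟ c) then 1 else 0
  atWitness (no _)        j = 0

  ∑-atWitness : ∀ d → ∑[ j < n ] atWitness d j ≡ indicator d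
  ∑-atWitness (yes (c , _)) = ∑-δ c 1
  ∑-atWitness (no _)        = ∑-zero n

  atWitness≤1 : ∀ d j → atWitness d j ℕ.≤ 1
  atWitness≤1 (yes (c , _)) j with j ≟ c
  ... | yes _ = ℕₚ.≤-refl
  ... | no  _ = z≤n
  atWitness≤1 (no _) j = z≤n

  atWitness-¬P : ∀ d j → ¬ P j → atWitness d j ≡ 0
  atWitness-¬P (yes (c , Pc)) j ¬Pj with j ≟ c
  ... | yes refl = contradiction Pc ¬Pj
  ... | no  _    = refl
  atWitness-¬P (no _) j ¬Pj = refl

module _ (G : Network) where
  open Network G

  inflowℕ outflowℕ : (V → V → ℕ) → V → ℕ
  inflowℕ g v  = sum (map (λ u → g u v) nodes)
  outflowℕ g v = sum (map (g v) nodes)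

  totalWeight : (V → V → ℕ) → ℕ
  totalWeight κ = sum (map (λ u → sum (map (κ u) nodes)) nodes)

  module _ (g : V → V → ℕ) where

    isFlow-ℕ : (∀ u v → g u v ℕ.≤ cap u v) →
               (∀ v → ¬ v ≡ s → ¬ v ≡ t → inflowℕ g v ≡ outflowℕ g v) →
               IsFlow G (λ u v → ℕtoℚ (g u v))
    isFlow-ℕ g≤cap conserves = record
      { nonneg       = λ u v → 0≤ℕtoℚ (g u v)
      ; capacity     = λ u v → ℕtoℚ-mono-≤ {g u v} (g≤cap u v)
      ; conservation = λ v v≢s v≢t → begin
          sumℚ (map (λ u → ℕtoℚ (g u v)) nodes)  ≡⟨ sumℚ-ℕtoℚ (λ u → g u v) nodes ⟩
          ℕtoℚ (inflowℕ g v)                     ≡⟨ cong ℕtoℚ (conserves v v≢s v≢t) ⟩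
          ℕtoℚ (outflowℕ g v)                    ≡⟨ sumℚ-ℕtoℚ (g v) nodes ⟨
          sumℚ (map (λ w → ℕtoℚ (g v w)) nodes)  ∎
      }
      where open ≡-Reasoning

    flowValue-ℕ : inflowℕ g s ≡ 0 → flowValue G (λ u v → ℕtoℚ (g u v)) ≡ ℕtoℚ (outflowℕ g s)
    flowValue-ℕ no-inflow = begin
      sumℚ (map (λ v → ℕtoℚ (g s v)) nodes) ℚ.- sumℚ (map (λ u → ℕtoℚ (g u s)) nodes)
        ≡⟨ cong₂ ℚ._-_ (sumℚ-ℕtoℚ (g s) nodes)
                       (trans (sumℚ-ℕtoℚ (λ u → g u s) nodes) (cong ℕtoℚ no-inflow)) ⟩
      ℕtoℚ (outflowℕ g s) ℚ.- 0ℚ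
        ≡⟨ ℚₚ.+-identityʳ (ℕtoℚ (outflowℕ g s)) ⟩
      ℕtoℚ (outflowℕ g s) ∎
      where open ≡-Reasoning

  -- Weak duality: by conservation the outflow of S minus its inflow is the flow value; in that
  -- difference the edges inside S cancel, those entering S count negatively, and those leaving S
  -- are bounded by κ.
  module _ {f : V → V → ℚ} (isFlow : IsFlow G f) (S : V → Bool) (κ : V → V → ℕ)
           (cap≤κ : ∀ u v → S u ≡ true → S v ≡ false → cap u v ℕ.≤ κ u v) where
    open IsFlow isFlow

    private
      outflowS inflowS : List V → ℚ
      outflowS us = sumℚ (map (λ u → if S u then outflow G f u else 0ℚ) us)
      inflowS  us = sumℚ (map (λ u → if S u then inflow G f u else 0ℚ) us)

      crossing-≤ : ∀ u v →
        (if S u then f u v else 0ℚ) ≤ (if S v then f u v else 0ℚ) ℚ.+ ℕtoℚ (κ u v)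
      crossing-≤ u v with S u in Su | S v in Sv
      ... | true  | true  = ℚₚ.≤-trans (ℚₚ.≤-reflexive (sym (ℚₚ.+-identityʳ _)))
                                       (ℚₚ.+-monoʳ-≤ (f u v) (0≤ℕtoℚ (κ u v)))
      ... | true  | false = ℚₚ.≤-trans (capacity u v)
                              (ℚₚ.≤-trans (ℕtoℚ-mono-≤ {cap u v} (cap≤κ u v Su Sv))
                                          (ℚₚ.≤-reflexive (sym (ℚₚ.+-identityˡ _))))
      ... | false | true  = ℚₚ.+-mono-≤ (nonneg u v) (0≤ℕtoℚ (κ u v))
      ... | false | false = ℚₚ.≤-trans (0≤ℕtoℚ (κ u v)) (ℚₚ.≤-reflexive (sym (ℚₚ.+-identityˡ _)))

      outflowS≤inflowS+weight : outflowS nodes ≤ inflowS nodes ℚ.+ ℕtoℚ (totalWeight κ)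
      outflowS≤inflowS+weight = begin
        outflowS nodes
          ≡⟨ sumℚ-cong (λ u → sumℚ-if (S u) (f u) nodes) nodes ⟩
        sumℚ (map (λ u → sumℚ (map (λ v → if S u then f u v else 0ℚ) nodes)) nodes)
          ≤⟨ sumℚ-mono-≤ (λ u → sumℚ-mono-≤ (crossing-≤ u) nodes) nodes ⟩
        sumℚ (map (λ u → sumℚ (map (λ v → stay u v ℚ.+ leave u v) nodes)) nodes)
          ≡⟨ sumℚ-cong (λ u → sumℚ-+ (stay u) (leave u) nodes) nodes ⟩
        sumℚ (map (λ u → sumℚ (map (stay u) nodes) ℚ.+ sumℚ (map (leave u) nodes)) nodes)
          ≡⟨ sumℚ-+ _ _ nodes ⟩
        sumℚ (map (λ u → sumℚ (map (stay u) nodes)) nodes) ℚ.+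
        sumℚ (map (λ u → sumℚ (map (leave u) nodes)) nodes)
          ≡⟨ cong₂ ℚ._+_ (sumℚ-swap stay nodes nodes) leaving ⟩
        sumℚ (map (λ v → sumℚ (map (λ u → stay u v) nodes)) nodes) ℚ.+ ℕtoℚ (totalWeight κ)
          ≡⟨ cong (ℚ._+ ℕtoℚ (totalWeight κ))
                  (sumℚ-cong (λ v → sumℚ-if (S v) (λ u → f u v) nodes) nodes) ⟨
        inflowS nodes ℚ.+ ℕtoℚ (totalWeight κ) ∎
        where
        open ℚₚ.≤-Reasoning
        stay leave : V → V → ℚ
        stay u v  = if S v then f u v else 0ℚ
        leave u v = ℕtoℚ (κ u v)
        leaving : sumℚ (map (λ u → sumℚ (map (leave u) nodes)) nodes) ≡ ℕtoℚ (totalWeight κ)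
        leaving = trans (sumℚ-cong (λ u → sumℚ-ℕtoℚ (κ u) nodes) nodes) (sumℚ-ℕtoℚ _ nodes)

      balanced : ∀ {us} → All (λ u → ¬ u ≡ s) us → S t ≡ false → outflowS us ≡ inflowS us
      balanced []                    St = refl
      balanced {u ∷ _} (u≢s ∷ us≢s) St = cong₂ ℚ._+_ balanced-at (balanced us≢s St)
        where
        balanced-at : (if S u then outflow G f u else 0ℚ) ≡ (if S u then inflow G f u else 0ℚ)
        balanced-at with S u in Su
        ... | true  = sym (conservation u u≢s (λ { refl → contradiction (trans (sym Su) St) λ () }))
        ... | false = refl

    flowValue≤cut : ∀ {others} → nodes ≡ s ∷ others → All (λ u → ¬ u ≡ s) others →
                    S s ≡ true → S t ≡ false → flowValue G f ≤ ℕtoℚ (totalWeight κ)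
    flowValue≤cut {others} nodes≡ others≢s Ss St =
      p+r≤q+r+s⇒p-q≤s (outflow G f s) (inflow G f s) (outflowS others) (ℕtoℚ (totalWeight κ))
        (subst₂ (λ x y → x ≤ y ℚ.+ ℕtoℚ (totalWeight κ))
          (split (outflow G f))
          (trans (split (inflow G f)) (cong (inflow G f s ℚ.+_) (sym (balanced others≢s St))))
          outflowS≤inflowS+weight)
      where
      split : ∀ (h : V → ℚ) → sumℚ (map (λ u → if S u then h u else 0ℚ) nodes) ≡
                             h s ℚ.+ sumℚ (map (λ u → if S u then h u else 0ℚ) others)
      split h rewrite nodes≡ | Ss = refl

  maxFlowValue-unique : ∀ {v w} → IsMaxFlowValue G v → IsMaxFlowValue G w → v ≡ w
  maxFlowValue-unique ((f , isFlow-f , refl) , v-max) ((g , isFlow-g , refl) , w-max) =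
    ℚₚ.≤-antisym (w-max f isFlow-f) (v-max g isFlow-g)

sum-allNodes : ∀ {N m} (h : Node N m → ℕ) → sum (map h (allNodes N m)) ≡
  h src + (h snk + (∑[ j < N ] h (nodeA j) + (∑[ j < N ] h (nodeB j) + ∑[ c < m ] h (nodeC c))))
sum-allNodes {N} {m} h = cong (λ z → h src + (h snk + z)) (begin
  sum (map h (As ++ Bs ++ Cs))
    ≡⟨ cong sum (Listₚ.map-++ h As (Bs ++ Cs)) ⟩
  sum (map h As ++ map h (Bs ++ Cs))
    ≡⟨ sum-++ (map h As) _ ⟩
  sum (map h As) + sum (map h (Bs ++ Cs))
    ≡⟨ cong (sum (map h As) +_) (trans (cong sum (Listₚ.map-++ h Bs Cs)) (sum-++ (map h Bs) _)) ⟩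
  sum (map h As) + (sum (map h Bs) + sum (map h Cs))
    ≡⟨ cong₂ _+_ (sum-map-allFin nodeA h)
                 (cong₂ _+_ (sum-map-allFin nodeB h) (sum-map-allFin nodeC h)) ⟩
  ∑[ j < N ] h (nodeA j) + (∑[ j < N ] h (nodeB j) + ∑[ c < m ] h (nodeC c)) ∎)
  where
  open ≡-Reasoning
  As Bs Cs : List (Node N m)
  As = map nodeA (allFin N)
  Bs = map nodeB (allFin N)
  Cs = map nodeC (allFin m)

module _ (k : ℕ) where

  merge : Assign k → Assign k → Fin (k + k) → Bool
  merge a b x = [ Vec.lookup a , Vec.lookup b ]′ (splitAt k x)

  restrictA restrictB : (Fin (k + k) → Bool) → Assign k
  restrictA σ = Vec.tabulate (σ ∘ join k k ∘ inj₁)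
  restrictB σ = Vec.tabulate (σ ∘ join k k ∘ inj₂)

  satLitA⇒merge : ∀ a b (l : Literal k) → SatLitA a l → SatLit {k} (merge a b) l
  satLitA⇒merge a b (x , p) with splitAt k x
  ... | inj₁ _ = λ sat → sat
  ... | inj₂ _ = λ ()

  satLitB⇒merge : ∀ a b (l : Literal k) → SatLitB b l → SatLit {k} (merge a b) l
  satLitB⇒merge a b (x , p) with splitAt k x
  ... | inj₁ _ = λ ()
  ... | inj₂ _ = λ sat → sat

  splitAt≡⇒join≡ : ∀ {x y} → splitAt k x ≡ y → join k k y ≡ x
  splitAt≡⇒join≡ {x} refl = Finₚ.join-splitAt k k x

  satLit-restrict : ∀ σ (l : Literal k) →
                    SatLit {k} σ l → SatLitA (restrictA σ) l ⊎ SatLitB (restrictB σ) l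
  satLit-restrict σ (x , p) sat with splitAt k x in split-x
  ... | inj₁ q = inj₁ (trans (Vecₚ.lookup∘tabulate _ q) (trans (cong σ (splitAt≡⇒join≡ split-x)) sat))
  ... | inj₂ q = inj₂ (trans (Vecₚ.lookup∘tabulate _ q) (trans (cong σ (splitAt≡⇒join≡ split-x)) sat))

  satisfiable-merge : ∀ (φ : CNF k) a b →
    (∀ c → SatClauseA a (List.lookup φ c) ⊎ SatClauseB b (List.lookup φ c)) → Satisfiable {k} φ
  satisfiable-merge φ a b sat = merge a b ,
    subst (All _) (Listₚ.tabulate-lookup φ)
      (All.tabulate⁺ (λ c → [ Any.map (satLitA⇒merge a b _) , Any.map (satLitB⇒merge a b _) ]′
                               (sat c)))

  satisfies-restrict : ∀ (φ : CNF k) σ → All (SatClause {k} σ) φ →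
    ∀ c → SatClauseA (restrictA σ) (List.lookup φ c) ⊎ SatClauseB (restrictB σ) (List.lookup φ c)
  satisfies-restrict φ σ sat c =
    Anyₚ.Any-⊎⁻ (Any.map (satLit-restrict σ _)
      (All.tabulate⁻ (subst (All _) (sym (Listₚ.tabulate-lookup φ)) sat) c))

module Phase {k} (φ : CNF k) (e : Fin (2 ^ k) → Assign k) (i : Fin (2 ^ k)) where

  N m : ℕ
  N = 2 ^ k
  m = length φ

  G : Network
  G = phaseNetwork φ e i

  nodes : List (Node N m)
  nodes = allNodes N m

  clause : Fin m → Clause k
  clause = List.lookup φ

  Falsifies : Fin N → Fin m → Set
  Falsifies b c = ¬ SatClauseA (e i) (clause c) × ¬ SatClauseB (e b) (clause c)

  falsifies? : ∀ b c → Dec (Falsifies b c)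
  falsifies? b c = ¬? (satClauseA? (e i) (clause c)) ×-dec ¬? (satClauseB? (e b) (clause c))

  Incompatible Compatible : Fin N → Set
  Incompatible b = ∃[ c ] Falsifies b c
  Compatible b   = ∀ c → SatClauseA (e i) (clause c) ⊎ SatClauseB (e b) (clause c)

  incompatible? : ∀ b → Dec (Incompatible b)
  incompatible? b = Finₚ.any? (falsifies? b)

  compatible⇒¬incompatible : ∀ {b} → Compatible b → ¬ Incompatible b
  compatible⇒¬incompatible compatible (c , ¬satA , ¬satB) = [ ¬satA , ¬satB ]′ (compatible c)

  ¬incompatible⇒compatible : ∀ {b} → ¬ Incompatible b → Compatible b
  ¬incompatible⇒compatible {b} ¬incompatible c
    with satClauseA? (e i) (clause c) | satClauseB? (e b) (clause c)
  ... | yes satA | _        = inj₁ satA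
  ... | no _     | yes satB = inj₂ satB
  ... | no ¬satA | no ¬satB = contradiction (c , ¬satA , ¬satB) ¬incompatible

  #incompatible : ℕ
  #incompatible = ∑[ b < N ] indicator (incompatible? b)

  #incompatible≤N : #incompatible ℕ.≤ N
  #incompatible≤N =
    ℕₚ.≤-trans (∑-mono-≤ (λ b → indicator≤1 (incompatible? b))) (ℕₚ.≤-reflexive (∑-ones N))

  load : Fin m → ℕ
  load c = ∑[ b < N ] atWitness (incompatible? b) c

  load≤N : ∀ c → load c ℕ.≤ N
  load≤N c =
    ℕₚ.≤-trans (∑-mono-≤ (λ b → atWitness≤1 (incompatible? b) c)) (ℕₚ.≤-reflexive (∑-ones N))

  total-load : ∑[ c < m ] load c ≡ #incompatible
  total-load = trans (∑-comm (λ c b → atWitness (incompatible? b) c))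
                     (sum-cong-≗ (λ b → ∑-atWitness (incompatible? b)))

  flow : Node N m → Node N m → ℕ
  flow src       (nodeA j) =
    (if does (toℕ j ℕ.<? toℕ i) then N else 0) + (if does (j ≟ i) then #incompatible else 0)
  flow (nodeA j) snk       = if does (toℕ j ℕ.<? toℕ i) then N else 0
  flow (nodeA j) (nodeC c) = if does (j ≟ i) then load c else 0
  flow (nodeC c) (nodeB b) = atWitness (incompatible? b) c
  flow (nodeB b) snk       = indicator (incompatible? b)
  flow _         _         = 0

  flow-conserves : ∀ v → ¬ v ≡ src → ¬ v ≡ snk → inflowℕ G flow v ≡ outflowℕ G flow v
  flow-conserves src v≢s _ = contradiction refl v≢s
  flow-conserves snk _ v≢t = contradiction refl v≢t
  flow-conserves (nodeA j) _ _
    rewrite sum-allNodes (λ u → flow u (nodeA j)) | sum-allNodes (flow (nodeA j)) | ∑-zero N | ∑-zero m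
          | ∑-if (does (j ≟ i)) load | total-load = ℕₚ.+-identityʳ _
  flow-conserves (nodeB b) _ _
    rewrite sum-allNodes (λ u → flow u (nodeB b)) | sum-allNodes (flow (nodeB b)) | ∑-zero N | ∑-zero m
          | ∑-atWitness (incompatible? b) = sym (ℕₚ.+-identityʳ _)
  flow-conserves (nodeC c) _ _
    rewrite sum-allNodes (λ u → flow u (nodeC c)) | sum-allNodes (flow (nodeC c)) | ∑-zero N | ∑-zero m
          | ∑-δ i (load c) = refl

  flow-≤-cap : ∀ u v → flow u v ℕ.≤ phaseCap φ e i u v
  flow-≤-cap src (nodeA j) = begin
    (if does (toℕ j ℕ.<? toℕ i) then N else 0) + (if does (j ≟ i) then #incompatible else 0)
      ≤⟨ ℕₚ.+-monoʳ-≤ _ (if-mono (does (j ≟ i))) ⟩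
    (if does (toℕ j ℕ.<? toℕ i) then N else 0) + (if does (j ≟ i) then N else 0)
      ≡⟨ ≤?-split j i N ⟨
    (if does (toℕ j ℕ.≤? toℕ i) then N else 0) ∎
    where
    open ℕₚ.≤-Reasoning
    if-mono : ∀ b → (if b then #incompatible else 0) ℕ.≤ (if b then N else 0)
    if-mono true  = #incompatible≤N
    if-mono false = z≤n
  flow-≤-cap (nodeA j) snk = ℕₚ.≤-refl
  flow-≤-cap (nodeA j) (nodeC c) with j ≟ i
  ... | no _ = z≤n
  ... | yes refl with satClauseA? (e i) (clause c)
  ...   | yes satA = ℕₚ.≤-reflexive (trans
            (sum-cong-≗ (λ b → atWitness-¬P (incompatible? b) c (λ falsifies → proj₁ falsifies satA)))
            (∑-zero N))
  ...   | no _     = load≤N c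
  flow-≤-cap (nodeC c) (nodeB b) with satClauseB? (e b) (clause c)
  ... | yes satB = ℕₚ.≤-reflexive (atWitness-¬P (incompatible? b) c (λ falsifies → proj₂ falsifies satB))
  ... | no _     = atWitness≤1 (incompatible? b) c
  flow-≤-cap (nodeB b) snk       = indicator≤1 (incompatible? b)
  flow-≤-cap src       src       = z≤n
  flow-≤-cap src       snk       = z≤n
  flow-≤-cap src       (nodeB _) = z≤n
  flow-≤-cap src       (nodeC _) = z≤n
  flow-≤-cap snk       _         = z≤n
  flow-≤-cap (nodeA _) src       = z≤n
  flow-≤-cap (nodeA _) (nodeA _) = z≤n
  flow-≤-cap (nodeA _) (nodeB _) = z≤n
  flow-≤-cap (nodeB _) src       = z≤n
  flow-≤-cap (nodeB _) (nodeA _) = z≤n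
  flow-≤-cap (nodeB _) (nodeB _) = z≤n
  flow-≤-cap (nodeB _) (nodeC _) = z≤n
  flow-≤-cap (nodeC _) src       = z≤n
  flow-≤-cap (nodeC _) snk       = z≤n
  flow-≤-cap (nodeC _) (nodeA _) = z≤n
  flow-≤-cap (nodeC _) (nodeC _) = z≤n

  outflow-src : outflowℕ G flow src ≡ toℕ i * N + #incompatible
  outflow-src
    rewrite sum-allNodes (flow src) | ∑-zero N | ∑-zero m
          | ∑-distrib-+ (λ j → if does (toℕ j ℕ.<? toℕ i) then N else 0)
                        (λ j → if does (j ≟ i) then #incompatible else 0)
          | ∑-below i N | ∑-δ i #incompatible = ℕₚ.+-identityʳ _

  inflow-src : inflowℕ G flow src ≡ 0
  inflow-src rewrite sum-allNodes (λ u → flow u src) | ∑-zero N | ∑-zero m = refl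

  flow-value : flowValue G (λ u v → ℕtoℚ (flow u v)) ≡ ℕtoℚ (toℕ i * N + #incompatible)
  flow-value = trans (flowValue-ℕ G flow inflow-src) (cong ℕtoℚ outflow-src)

  inCut : Node N m → Bool
  inCut src       = true
  inCut snk       = false
  inCut (nodeA j) = does (j ≟ i)
  inCut (nodeB b) = does (incompatible? b)
  inCut (nodeC c) = not (does (satClauseA? (e i) (clause c)))

  cutBound : Node N m → Node N m → ℕ
  cutBound src       (nodeA j) = if does (toℕ j ℕ.<? toℕ i) then N else 0
  cutBound (nodeB b) snk       = indicator (incompatible? b)
  cutBound _         _         = 0

  cap-≤-cutBound : ∀ u v → inCut u ≡ true → inCut v ≡ false → phaseCap φ e i u v ℕ.≤ cutBound u v
  cap-≤-cutBound src (nodeA j) _ j∉ rewrite ≤?-split j i N | j∉ = ℕₚ.≤-reflexive (ℕₚ.+-identityʳ _)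
  cap-≤-cutBound (nodeA j) snk j∈ _ with j ≟ i
  ... | yes refl rewrite dec-false (toℕ j ℕ.<? toℕ j) (ℕₚ.<-irrefl refl) = z≤n
  cap-≤-cutBound (nodeA j) snk () _ | no _
  cap-≤-cutBound (nodeA j) (nodeC c) j∈ c∉ with j ≟ i
  cap-≤-cutBound (nodeA j) (nodeC c) () c∉ | no _
  ... | yes refl with satClauseA? (e i) (clause c)
  ...   | yes _ = z≤n
  cap-≤-cutBound (nodeA j) (nodeC c) _ () | yes refl | no _
  cap-≤-cutBound (nodeB b) snk b∈ _ rewrite b∈ = ℕₚ.≤-refl
  cap-≤-cutBound (nodeC c) (nodeB b) c∈ b∉ with satClauseB? (e b) (clause c)
  ... | yes _ = z≤n
  ... | no ¬satB with satClauseA? (e i) (clause c)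
  cap-≤-cutBound (nodeC c) (nodeB b) () b∉ | no ¬satB | yes _
  ... | no ¬satA = contradiction (trans (sym (dec-true (incompatible? b) (c , ¬satA , ¬satB))) b∉) λ ()
  cap-≤-cutBound src       src       _  ()
  cap-≤-cutBound src       snk       _  _ = z≤n
  cap-≤-cutBound src       (nodeB _) _  _ = z≤n
  cap-≤-cutBound src       (nodeC _) _  _ = z≤n
  cap-≤-cutBound snk       _         () _
  cap-≤-cutBound (nodeA _) src       _  ()
  cap-≤-cutBound (nodeA _) (nodeA _) _  _ = z≤n
  cap-≤-cutBound (nodeA _) (nodeB _) _  _ = z≤n
  cap-≤-cutBound (nodeB _) src       _  ()
  cap-≤-cutBound (nodeB _) (nodeA _) _  _ = z≤n
  cap-≤-cutBound (nodeB _) (nodeB _) _  _ = z≤n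
  cap-≤-cutBound (nodeB _) (nodeC _) _  _ = z≤n
  cap-≤-cutBound (nodeC _) src       _  ()
  cap-≤-cutBound (nodeC _) snk       _  _ = z≤n
  cap-≤-cutBound (nodeC _) (nodeA _) _  _ = z≤n
  cap-≤-cutBound (nodeC _) (nodeC _) _  _ = z≤n

  cutBound-src : sum (map (cutBound src) nodes) ≡ toℕ i * N
  cutBound-src rewrite sum-allNodes (cutBound src) | ∑-zero N | ∑-zero m | ∑-below i N = ℕₚ.+-identityʳ _

  cutBound-nodeB : ∀ b → sum (map (cutBound (nodeB b)) nodes) ≡ indicator (incompatible? b)
  cutBound-nodeB b rewrite sum-allNodes (cutBound (nodeB b)) | ∑-zero N | ∑-zero m = ℕₚ.+-identityʳ _

  cutBound-total : totalWeight G cutBound ≡ toℕ i * N + #incompatible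
  cutBound-total
    rewrite sum-allNodes (λ u → sum (map (cutBound u) nodes)) | sum-map-zero nodes | ∑-zero N | ∑-zero m
          | cutBound-src | sum-cong-≗ cutBound-nodeB = cong (toℕ i * N +_) (ℕₚ.+-identityʳ _)

  src∉tail : All (λ u → ¬ u ≡ src) (List.drop 1 nodes)
  src∉tail = (λ ()) ∷ All.++⁺ (All.map⁺ {f = nodeA} (universal (λ _ ()) (allFin N)))
                        (All.++⁺ (All.map⁺ {f = nodeB} (universal (λ _ ()) (allFin N)))
                                 (All.map⁺ {f = nodeC} (universal (λ _ ()) (allFin m))))

  maxFlowValue : IsMaxFlowValue G (ℕtoℚ (toℕ i * N + #incompatible))
  maxFlowValue =
    ((λ u v → ℕtoℚ (flow u v)) , isFlow-ℕ G flow flow-≤-cap flow-conserves , flow-value) ,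
    λ f isFlow → subst (flowValue G f ≤_) (cong ℕtoℚ cutBound-total)
      (flowValue≤cut G isFlow inCut cutBound cap-≤-cutBound refl src∉tail refl refl)

  maxFlow<⇒compatible : ∀ {v} → IsMaxFlowValue G v → v < ℕtoℚ (suc (toℕ i) ℕ.* N) →
                        ∃[ b ] Compatible b
  maxFlow<⇒compatible {v} v-max v< with Finₚ.any? (λ b → ¬? (incompatible? b))
  ... | yes (b , ¬incompatible) = b , ¬incompatible⇒compatible ¬incompatible
  ... | no none = contradiction v<
    (ℚₚ.<-irrefl (trans (maxFlowValue-unique G v-max maxFlowValue) (cong ℕtoℚ all-incompatible)))
    where
    all-incompatible : toℕ i * N + #incompatible ≡ suc (toℕ i) ℕ.* N
    all-incompatible = begin
      toℕ i * N + #incompatible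
        ≡⟨ cong (toℕ i * N +_) (sum-cong-≗ (λ b → indicator-yes (incompatible? b)
             (decidable-stable (incompatible? b) (λ ¬incompatible → none (b , ¬incompatible))))) ⟩
      toℕ i * N + ∑[ b < N ] 1  ≡⟨ cong (toℕ i * N +_) (∑-ones N) ⟩
      toℕ i * N + N             ≡⟨ ℕₚ.+-comm (toℕ i * N) N ⟩
      suc (toℕ i) ℕ.* N         ∎
      where open ≡-Reasoning

  compatible⇒¬maxFlow≥ : ∀ {b} → Compatible b →
                         ¬ (∀ v → IsMaxFlowValue G v → ℕtoℚ (suc (toℕ i) ℕ.* N) ≤ v)
  compatible⇒¬maxFlow≥ {b} compatible maxFlow≥ =
    ℕₚ.<⇒≱ maxFlow<N (ℕtoℚ-cancel-≤ (maxFlow≥ _ maxFlowValue))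
    where
    #incompatible<N : #incompatible ℕ.< N
    #incompatible<N = ℕₚ.<-≤-trans
      (∑-mono-< (λ b' → indicator≤1 (incompatible? b')) b
        (ℕₚ.≤-reflexive (cong suc (indicator-no (incompatible? b) (compatible⇒¬incompatible compatible)))))
      (ℕₚ.≤-reflexive (∑-ones N))
    maxFlow<N : toℕ i * N + #incompatible ℕ.< suc (toℕ i) ℕ.* N
    maxFlow<N = ℕₚ.<-≤-trans (ℕₚ.+-monoʳ-< (toℕ i * N) #incompatible<N)
                             (ℕₚ.≤-reflexive (ℕₚ.+-comm (toℕ i * N) N))

lemma2 : (k : ℕ) (φ : CNF k) (e : Fin (2 ^ k) → Assign k) →
    Bijective _≡_ _≡_ e →
    ((∃[ i ] ∃[ v ] (IsMaxFlowValue (phaseNetwork φ e i) v × v < ℕtoℚ (suc (toℕ i) ℕ.* 2 ^ k))) → Satisfiable {k} φ)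
    × ((∀ i v → IsMaxFlowValue (phaseNetwork φ e i) v → ℕtoℚ (suc (toℕ i) ℕ.* 2 ^ k) ≤ v) → ¬ Satisfiable {k} φ)
lemma2 k φ e (_ , surjective) = satisfiable , unsatisfiable
  where
  satisfiable : (∃[ i ] ∃[ v ] (IsMaxFlowValue (phaseNetwork φ e i) v × v < ℕtoℚ (suc (toℕ i) ℕ.* 2 ^ k))) →
                Satisfiable {k} φ
  satisfiable (i , v , v-max , v<) with Phase.maxFlow<⇒compatible φ e i v-max v<
  ... | b , compatible = satisfiable-merge k φ (e i) (e b) compatible

  unsatisfiable : (∀ i v → IsMaxFlowValue (phaseNetwork φ e i) v → ℕtoℚ (suc (toℕ i) ℕ.* 2 ^ k) ≤ v) →
                  ¬ Satisfiable {k} φ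
  unsatisfiable maxFlow≥ (σ , sat) = Phase.compatible⇒¬maxFlow≥ φ e i compatible (maxFlow≥ i)
    where
    i b : Fin (2 ^ k)
    i = proj₁ (surjective (restrictA k σ))
    b = proj₁ (surjective (restrictB k σ))
    compatible : Phase.Compatible φ e i b
    compatible c = subst₂ (λ a a′ → SatClauseA a (List.lookup φ c) ⊎ SatClauseB a′ (List.lookup φ c))
      (sym (proj₂ (surjective (restrictA k σ)) refl)) (sym (proj₂ (surjective (restrictB k σ)) refl))
      (satisfies-restrict k φ σ sat c)
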